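{- Let $t\ge 1$ and $q\ge 0$ be integers, and let $D_m$, $D^m$, $L_m$ and the operation $\mathcal{M}$ be as defined below. For every integer $D$ with $D_m\le D\le D^m$ there exists a finite sequence $L=(\ell_1,\ell_2,\dots,\ell_d)$ such that (i) $\sum_{i=1}^d \ell_i=2q$; (ii) $2\le \ell_i\le 2^{i+1}$ for $i<d$ and $1\le \ell_d\le 2^{d+1}$; (iii) $\ell_{i+1}\le 2\ell_i$ (for all $i$ with $1\le i<d$). Namely, $L=\mathcal{M}^{D-D_m}(L_m)$.
   Context: Let $a=\lfloor\log_2(2q+3)\rfloor$. Define $D_m=(3t+1)2q-2^{a+1}+(a+1)2q+4a$ and $D^m=(3t+1)2q+q^2+5q$. The short sequence is $L_m=(\ell_1,\dots,\ell_{a-1})$ with $\ell_i=2^{i+1}$ for $1\le i\le a-2$ and $\ell_{a-1}=2q-2^a+4$ (so $L_m=(4,8,16,\dots)$). The operation $\mathcal{M}$ on a sequence $L=(\ell_1,\dots,\ell_d)$ of positive integers: set $\ell_{d+1}=0$; let $i$ be the smallest index such that $\ell_i\ge 3$ and either (a) $2(\ell_i-1)>\ell_{i+1}+1$, or (b) $\ell_i=\ell_{i+1}=3$. Then $\mathcal{M}(L)=(\ell_1',\dots)$ where $\ell'_j=\ell_j$ for all $1\le j\le d+1$ except $\ell'_i=\ell_i-1$ and $\ell'_{i+1}=\ell_{i+1}+1$ (a final term equal to $0$ is dropped, so the length increases to $d+1$ exactly when $i=d$). $\mathcal{M}^k$ denotes $k$-fold application. For example, for $2q=20$ the iterates start $(4,8,8),(4,7,9),(4,6,10),(4,6,9,1),(4,6,8,2),\dots$.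 -}

module Defs where

open import Data.Nat using (ℕ; zero; suc; _+_; _*_; _∸_; _^_; _≤_; _<_)
open import Data.Nat.Logarithm using (⌊log₂_⌋)
open import Data.Bool using (Bool; true; false; _∧_; _∨_; if_then_else_)
open import Data.Nat using (_≤ᵇ_; _<ᵇ_; _≡ᵇ_)
open import Data.List using (List; []; _∷_; map; upTo; _++_; [_]; length; lookup)
open import Data.Nat.ListAction using (sum)
open import Data.Maybe using (Maybe; just; nothing; _>>=_)
import Data.Maybe as Maybe
open import Data.Integer as ℤ using (ℤ; +_)
open import Data.Fin using (Fin; toℕ)
open import Data.Product using (_×_)

aOf : ℕ → ℕ
aOf q = ⌊log₂ (2 * q + 3) ⌋

Dmin : ℕ → ℕ → ℤ
Dmin t q = (+ ((3 * t + 1) * (2 * q))) ℤ.- (+ (2 ^ (aOf q + 1)))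
           ℤ.+ (+ ((aOf q + 1) * (2 * q))) ℤ.+ (+ (4 * aOf q))

Dmax : ℕ → ℕ → ℤ
Dmax t q = + ((3 * t + 1) * (2 * q) + q * q + 5 * q)

-- L_m = (ℓ_1,…,ℓ_{a-1}), ℓ_i = 2^{i+1} (i ≤ a-2), ℓ_{a-1} = 2q − 2^a + 4
-- (2^a ≤ 2q+3, so the truncated subtraction is exact.)
LmAux : ℕ → ℕ → List ℕ
LmAux q zero = []
LmAux q (suc zero) = []
LmAux q (suc (suc k)) =
  map (λ i → 2 ^ (i + 2)) (upTo k) ++ [ (2 * q + 4) ∸ 2 ^ (suc (suc k)) ]

Lm : ℕ → List ℕ
Lm q = LmAux q (aOf q)

-- head of a list, with ℓ_{d+1} = 0 convention
hd0 : List ℕ → ℕ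
hd0 [] = 0
hd0 (y ∷ _) = y

incHead : List ℕ → List ℕ
incHead [] = 1 ∷ []
incHead (y ∷ ys) = suc y ∷ ys

-- condition at index i with ℓ_i = x and ℓ_{i+1} = n (0 if i = d):
-- ℓ_i ≥ 3 and ( 2(ℓ_i − 1) > ℓ_{i+1} + 1  or  ℓ_i = ℓ_{i+1} = 3 )
-- (case (b) can only happen for i < d since it needs ℓ_{i+1} = 3)
cond : ℕ → ℕ → Bool
cond x n = (3 ≤ᵇ x) ∧ ((n + 1 <ᵇ 2 * (x ∸ 1)) ∨ ((x ≡ᵇ 3) ∧ (n ≡ᵇ 3)))

-- the operation 𝓜; nothing if no index i satisfies the condition (𝓜 undefined)
M : List ℕ → Maybe (List ℕ)
M [] = nothing
M (x ∷ rest) =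
  if cond x (hd0 rest)
  then just ((x ∸ 1) ∷ incHead rest)
  else Maybe.map (x ∷_) (M rest)

Miter : ℕ → List ℕ → Maybe (List ℕ)
Miter zero L = just L
Miter (suc k) L = M L >>= Miter k

-- properties (i)–(iii); indices are 0-based: position j corresponds to ℓ_{j+1}
GoodSeq : ℕ → List ℕ → Set
GoodSeq q L =
  (sum L ≡ 2 * q)
  × (∀ (j : Fin (length L)) → suc (toℕ j) < length L →
        2 ≤ lookup L j × lookup L j ≤ 2 ^ (toℕ j + 2))
  × (∀ (j : Fin (length L)) → suc (toℕ j) ≡ length L →
        1 ≤ lookup L j × lookup L j ≤ 2 ^ (toℕ j + 2))
  × (∀ (j j' : Fin (length L)) → toℕ j' ≡ suc (toℕ j) →
        lookup L j' ≤ 2 * lookup L j)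
  where open import Relation.Binary.PropositionalEquality using (_≡_)

{-# OPTIONS --safe #-}
-- Let w(L) = Σᵢ i·ℓᵢ. One application of 𝓜 keeps the sum of L, raises w by exactly one and
-- preserves (ii) and (iii). If 𝓜 is undefined on a list with (ii) and (iii), every entry is at
-- most 2, so L = (2, …, 2) or (2, …, 2, 1) and 4w(L) ≥ s² + 2s for s = 2q, i.e. w(L) ≥ q² + q.
-- As w(L_m) = D_m − (3t+1)2q − 4q and q² + q = D^m − (3t+1)2q − 4q, each of the D − D_m
-- applications of 𝓜 starting from L_m meets a list with w < q² + q, on which 𝓜 is defined.
module Submission where

open import Defs
open import Data.Nat
open import Data.Nat.Properties
open import Data.Nat.Logarithm
open import Data.Nat.ListAction using (sum)
open import Data.Nat.Tactic.RingSolver using (solve-∀)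
open import Data.Bool using (true; false; T)
open import Data.Bool.Properties using (T-∧; T-∨)
open import Data.List using (List; []; _∷_; _++_; [_]; length; lookup; applyUpTo)
open import Data.List.Properties using (map-upTo)
open import Data.List.Relation.Unary.All using (All; []; _∷_)
open import Data.Maybe using (just; nothing)
open import Data.Fin using (toℕ; zero; suc)
open import Data.Integer as ℤ using (ℤ)
import Data.Integer.Properties as ℤ
import Data.Integer.Tactic.RingSolver as ℤ
open import Data.Product using (Σ; ∃-syntax; _×_; _,_; proj₂)
open import Data.Sum using (inj₁; inj₂)
open import Data.Unit using (⊤; tt)
open import Data.Empty using (⊥-elim)
open import Function.Bundles using (Equivalence)
open import Relation.Binary.PropositionalEquality hiding ([_])
open import Relation.Nullary using (yes; no)

cond⇒bounds : ∀ x n → T (cond x n) → 3 ≤ x × suc n ≤ 2 * (x ∸ 1)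
cond⇒bounds x n h with Equivalence.to T-∧ h
... | 3≤ᵇx , h′ with Equivalence.to T-∨ h′
...   | inj₁ n+1<ᵇ = ≤ᵇ⇒≤ 3 x 3≤ᵇx , <⇒≤ (subst (_< 2 * (x ∸ 1)) (+-comm n 1) (<ᵇ⇒< (n + 1) _ n+1<ᵇ))
...   | inj₂ both with Equivalence.to (T-∧ {x ≡ᵇ 3}) both
...     | x≡ᵇ3 , n≡ᵇ3 rewrite ≡ᵇ⇒≡ x 3 x≡ᵇ3 | ≡ᵇ⇒≡ n 3 n≡ᵇ3 = ≤-refl , ≤-refl

cond-small-successor : ∀ {x n} → 3 ≤ x → n ≤ 2 → T (cond x n)
cond-small-successor {x} {n} 3≤x n≤2 =
  Equivalence.from T-∧ (≤⇒≤ᵇ 3≤x , Equivalence.from T-∨ (inj₁ (<⇒<ᵇ n+1<)))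
  where
  open ≤-Reasoning
  n+1< : n + 1 < 2 * (x ∸ 1)
  n+1< = begin-strict
    n + 1         ≤⟨ +-monoˡ-≤ 1 n≤2 ⟩
    3             <⟨ n<1+n 3 ⟩
    2 * (3 ∸ 1)   ≤⟨ *-monoʳ-≤ 2 (∸-monoˡ-≤ 1 3≤x) ⟩
    2 * (x ∸ 1)   ∎

-- 𝓜 L ≡ just L′, retaining only what the chosen index i satisfies.
data Step : List ℕ → List ℕ → Set where
  here  : ∀ {x rest} → 3 ≤ x → suc (hd0 rest) ≤ 2 * (x ∸ 1) →
          Step (x ∷ rest) ((x ∸ 1) ∷ incHead rest)
  there : ∀ {x rest rest′} → Step rest rest′ → Step (x ∷ rest) (x ∷ rest′)

M≡just⇒Step : ∀ L {L′} → M L ≡ just L′ → Step L L′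
M≡just⇒Step (x ∷ rest) eq with cond x (hd0 rest) in c
M≡just⇒Step (x ∷ rest) refl | true =
  let 3≤x , next≤ = cond⇒bounds x (hd0 rest) (subst T (sym c) tt) in here 3≤x next≤
M≡just⇒Step (x ∷ rest) eq   | false with M rest in e
M≡just⇒Step (x ∷ rest) refl | false | just _ = there (M≡just⇒Step rest e)

All≤⇒hd0≤ : ∀ {n L} → All (_≤ n) L → hd0 L ≤ n
All≤⇒hd0≤ []       = z≤n
All≤⇒hd0≤ (x≤n ∷ _) = x≤n

M≡nothing⇒All≤2 : ∀ L → M L ≡ nothing → All (_≤ 2) L
M≡nothing⇒All≤2 []         _  = []
M≡nothing⇒All≤2 (x ∷ rest) eq with cond x (hd0 rest) in c
M≡nothing⇒All≤2 (x ∷ rest) () | true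
M≡nothing⇒All≤2 (x ∷ rest) eq | false with M rest in e
M≡nothing⇒All≤2 (x ∷ rest) eq | false | nothing = x≤2 ∷ rest≤2
  where
  rest≤2 : All (_≤ 2) rest
  rest≤2 = M≡nothing⇒All≤2 rest e
  x≤2 : x ≤ 2
  x≤2 with x ≤? 2
  ... | yes x≤2 = x≤2
  ... | no x≰2  = ⊥-elim (subst T c (cond-small-successor (≰⇒> x≰2) (All≤⇒hd0≤ rest≤2)))

-- w(L) = Σᵢ i·ℓᵢ, written as the sum of the suffix sums.
moment : List ℕ → ℕ
moment []       = 0
moment (x ∷ xs) = sum (x ∷ xs) + moment xs

sum-incHead : ∀ L → sum (incHead L) ≡ suc (sum L)
sum-incHead []      = refl
sum-incHead (_ ∷ _) = refl

moment-incHead : ∀ L → moment (incHead L) ≡ suc (moment L)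
moment-incHead []      = refl
moment-incHead (_ ∷ _) = refl

Step-sum : ∀ {L L′} → Step L L′ → sum L′ ≡ sum L
Step-sum (here {x} {rest} 3≤x _) = begin
  (x ∸ 1) + sum (incHead rest) ≡⟨ cong ((x ∸ 1) +_) (sum-incHead rest) ⟩
  (x ∸ 1) + suc (sum rest)     ≡⟨ +-suc (x ∸ 1) (sum rest) ⟩
  suc (x ∸ 1) + sum rest       ≡⟨ cong (_+ sum rest) (m+[n∸m]≡n 1≤x) ⟩
  x + sum rest                 ∎
  where
  open ≡-Reasoning
  1≤x : 1 ≤ x
  1≤x = ≤-trans (s≤s z≤n) 3≤x
Step-sum (there {x} s) = cong (x +_) (Step-sum s)

Step-moment : ∀ {L L′} → Step L L′ → moment L′ ≡ suc (moment L)
Step-moment s@(here {rest = rest} _ _) =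
  trans (cong₂ _+_ (Step-sum s) (moment-incHead rest)) (+-suc _ (moment rest))
Step-moment s@(there s′) =
  trans (cong₂ _+_ (Step-sum s) (Step-moment s′)) (+-suc _ _)

entryMin : List ℕ → ℕ
entryMin []      = 1
entryMin (_ ∷ _) = 2

-- Properties (ii) and (iii) for a list whose first entry sits at 0-based position p.
GoodFrom : ℕ → List ℕ → Set
GoodFrom p []         = ⊤
GoodFrom p (x ∷ rest) =
  entryMin rest ≤ x × x ≤ 2 ^ (p + 2) × hd0 rest ≤ 2 * x × GoodFrom (suc p) rest

GoodFrom-incHead : ∀ {p} L → GoodFrom p L → suc (hd0 L) ≤ 2 ^ (p + 2) → GoodFrom p (incHead L)
GoodFrom-incHead []      _                     1≤2^ = ≤-refl , 1≤2^ , z≤n , tt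
GoodFrom-incHead (y ∷ _) (lo , _ , dbl , good) y<2^ =
  m≤n⇒m≤1+n lo , y<2^ , ≤-trans dbl (*-monoʳ-≤ 2 (n≤1+n y)) , good

entryMin-incHead : ∀ L → entryMin (incHead L) ≡ 2
entryMin-incHead []      = refl
entryMin-incHead (_ ∷ _) = refl

hd0-incHead : ∀ L → hd0 (incHead L) ≡ suc (hd0 L)
hd0-incHead []      = refl
hd0-incHead (_ ∷ _) = refl

Step-hd0 : ∀ {L L′} → Step L L′ → hd0 L′ ≤ hd0 L
Step-hd0 (here {x} _ _) = m∸n≤m x 1
Step-hd0 (there _)      = ≤-refl

Step-entryMin : ∀ {L L′} → Step L L′ → entryMin L′ ≡ entryMin L
Step-entryMin (here _ _) = refl
Step-entryMin (there _)  = refl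

Step-GoodFrom : ∀ {p L L′} → Step L L′ → GoodFrom p L → GoodFrom p L′
Step-GoodFrom {p} (here {x} {rest} 3≤x next≤) (_ , x≤2^ , _ , good) =
  subst (_≤ x ∸ 1) (sym (entryMin-incHead rest)) 2≤x∸1 ,
  ≤-trans (m∸n≤m x 1) x≤2^ ,
  subst (_≤ 2 * (x ∸ 1)) (sym (hd0-incHead rest)) next≤ ,
  GoodFrom-incHead rest good next≤2^
  where
  2≤x∸1 : 2 ≤ x ∸ 1
  2≤x∸1 = ∸-monoˡ-≤ 1 3≤x
  next≤2^ : suc (hd0 rest) ≤ 2 ^ (suc p + 2)
  next≤2^ = ≤-trans next≤ (*-monoʳ-≤ 2 (≤-trans (m∸n≤m x 1) x≤2^))
Step-GoodFrom (there s) (lo , x≤2^ , dbl , good) =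
  subst (_≤ _) (sym (Step-entryMin s)) lo , x≤2^ , ≤-trans (Step-hd0 s) dbl , Step-GoodFrom s good

All≤2⇒moment-bound : ∀ {p} L → GoodFrom p L → All (_≤ 2) L →
  sum L * sum L + 2 * sum L ≤ 4 * moment L
All≤2⇒moment-bound []                        _         _         = z≤n
All≤2⇒moment-bound (1 ∷ [])                  _         _         = n≤1+n 3
All≤2⇒moment-bound (2 ∷ [])                  _         _         = ≤-refl
All≤2⇒moment-bound (suc (suc (suc _)) ∷ [])  _         (s≤s (s≤s ()) ∷ _)
All≤2⇒moment-bound (x ∷ y ∷ ys) (2≤x , _ , _ , good) (x≤2 ∷ rest≤2)
  with ≤-antisym x≤2 2≤x
... | refl = begin
  (2 + s) * (2 + s) + 2 * (2 + s)   ≡⟨ expand s ⟩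
  4 * (2 + s) + (s * s + 2 * s)     ≤⟨ +-monoʳ-≤ (4 * (2 + s)) (All≤2⇒moment-bound (y ∷ ys) good rest≤2) ⟩
  4 * (2 + s) + 4 * moment (y ∷ ys) ≡⟨ sym (*-distribˡ-+ 4 (2 + s) _) ⟩
  4 * (2 + s + moment (y ∷ ys))     ∎
  where
  open ≤-Reasoning
  s = sum (y ∷ ys)
  expand : ∀ s → (2 + s) * (2 + s) + 2 * (2 + s) ≡ 4 * (2 + s) + (s * s + 2 * s)
  expand = solve-∀

Miter-GoodFrom : ∀ {p} q k L → GoodFrom p L → sum L ≡ 2 * q → moment L + k ≤ q * q + q →
  ∃[ L′ ] Miter k L ≡ just L′ × GoodFrom p L′ × sum L′ ≡ 2 * q
Miter-GoodFrom q zero L good sum≡ _ = L , refl , good , sum≡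
Miter-GoodFrom q (suc k) L good sum≡ bound with M L in e
... | just L′ = Miter-GoodFrom q k L′ (Step-GoodFrom step good) (trans (Step-sum step) sum≡) bound′
  where
  step = M≡just⇒Step L e
  bound′ : moment L′ + k ≤ q * q + q
  bound′ = subst (_≤ q * q + q) (trans (+-suc (moment L) k) (cong (_+ k) (sym (Step-moment step)))) bound
... | nothing = ⊥-elim (<⇒≱ 4moment< (All≤2⇒moment-bound L good (M≡nothing⇒All≤2 L e)))
  where
  open ≤-Reasoning
  square : ∀ q → 4 * (q * q + q) ≡ 2 * q * (2 * q) + 2 * (2 * q)
  square = solve-∀
  4moment< : 4 * moment L < sum L * sum L + 2 * sum L
  4moment< = begin-strict
    4 * moment L                  <⟨ *-monoʳ-< 4 (<-≤-trans (m<m+n (moment L) (s≤s z≤n)) bound) ⟩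
    4 * (q * q + q)               ≡⟨ square q ⟩
    2 * q * (2 * q) + 2 * (2 * q) ≡⟨ cong (λ s → s * s + 2 * s) (sym sum≡) ⟩
    sum L * sum L + 2 * sum L     ∎

lookup-≤2^ : ∀ {p} L → GoodFrom p L → ∀ j → lookup L j ≤ 2 ^ (toℕ j + p + 2)
lookup-≤2^ (_ ∷ _)        (_ , x≤2^ , _)    zero    = x≤2^
lookup-≤2^ {p} (_ ∷ rest) (_ , _ , _ , good) (suc j) =
  subst (λ e → lookup rest j ≤ 2 ^ (e + 2)) (+-suc (toℕ j) p) (lookup-≤2^ rest good j)

lookup-inner-≥2 : ∀ {p} L → GoodFrom p L → ∀ j → suc (toℕ j) < length L → 2 ≤ lookup L j
lookup-inner-≥2 (_ ∷ [])     _                  zero    (s≤s ())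
lookup-inner-≥2 (_ ∷ _ ∷ _)  (2≤x , _)          zero    _         = 2≤x
lookup-inner-≥2 (_ ∷ rest)   (_ , _ , _ , good) (suc j) (s≤s j<) = lookup-inner-≥2 rest good j j<

lookup-last-≥1 : ∀ {p} L → GoodFrom p L → ∀ j → suc (toℕ j) ≡ length L → 1 ≤ lookup L j
lookup-last-≥1 (_ ∷ [])    (1≤x , _)          zero    _  = 1≤x
lookup-last-≥1 (_ ∷ _ ∷ _) _                  zero    ()
lookup-last-≥1 (_ ∷ rest)  (_ , _ , _ , good) (suc j) eq = lookup-last-≥1 rest good j (suc-injective eq)

lookup-doubling : ∀ {p} L → GoodFrom p L → ∀ j j′ → toℕ j′ ≡ suc (toℕ j) →
  lookup L j′ ≤ 2 * lookup L j
lookup-doubling (_ ∷ _ ∷ _) (_ , _ , dbl , _)  zero    (suc zero)    _  = dbl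
lookup-doubling (_ ∷ rest)  (_ , _ , _ , good) (suc j) (suc j′)      eq =
  lookup-doubling rest good j j′ (suc-injective eq)
lookup-doubling (_ ∷ _)     _                  zero    zero          ()
lookup-doubling (_ ∷ _ ∷ _) _                  zero    (suc (suc _)) ()
lookup-doubling (_ ∷ _)     _                  (suc _) zero          ()

GoodFrom⇒GoodSeq : ∀ q L → GoodFrom 0 L → sum L ≡ 2 * q → GoodSeq q L
GoodFrom⇒GoodSeq q L good sum≡ =
  sum≡ ,
  (λ j inner → lookup-inner-≥2 L good j inner , entry≤2^ j) ,
  (λ j last → lookup-last-≥1 L good j last , entry≤2^ j) ,
  lookup-doubling L good
  where
  entry≤2^ : ∀ j → lookup L j ≤ 2 ^ (toℕ j + 2)
  entry≤2^ j = subst (λ e → lookup L j ≤ 2 ^ (e + 2)) (+-identityʳ (toℕ j)) (lookup-≤2^ L good j)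

2*⌊n/2⌋≤n : ∀ n → 2 * ⌊ n /2⌋ ≤ n
2*⌊n/2⌋≤n n = begin
  2 * ⌊ n /2⌋         ≡⟨ cong (⌊ n /2⌋ +_) (+-identityʳ _) ⟩
  ⌊ n /2⌋ + ⌊ n /2⌋   ≤⟨ +-monoʳ-≤ ⌊ n /2⌋ (⌊n/2⌋≤⌈n/2⌉ n) ⟩
  ⌊ n /2⌋ + ⌈ n /2⌉   ≡⟨ ⌊n/2⌋+⌈n/2⌉≡n n ⟩
  n                   ∎
  where open ≤-Reasoning

2^⌊log₂n⌋≤n : ∀ n → 1 ≤ n → 2 ^ ⌊log₂ n ⌋ ≤ n
2^⌊log₂n⌋≤n n = bound ⌊log₂ n ⌋ n refl
  where
  open ≤-Reasoning
  bound : ∀ k m → ⌊log₂ m ⌋ ≡ k → 1 ≤ m → 2 ^ k ≤ m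
  bound zero    _                _    1≤m = 1≤m
  bound (suc k) 1                ()   _
  bound (suc k) m@(suc (suc _)) log≡ _   = begin
    2 * 2 ^ k    ≤⟨ *-monoʳ-≤ 2 (bound k ⌊ m /2⌋ log-half≡ (s≤s z≤n)) ⟩
    2 * ⌊ m /2⌋  ≤⟨ 2*⌊n/2⌋≤n m ⟩
    m            ∎
    where
    log-half≡ : ⌊log₂ ⌊ m /2⌋ ⌋ ≡ k
    log-half≡ = trans (⌊log₂⌊n/2⌋⌋≡⌊log₂n⌋∸1 m) (cong (_∸ 1) log≡)

n<2*2^⌊log₂n⌋ : ∀ n → n < 2 * 2 ^ ⌊log₂ n ⌋
n<2*2^⌊log₂n⌋ n with 2 * 2 ^ ⌊log₂ n ⌋ ≤? n
... | no  2^≰n = ≰⇒> 2^≰n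
... | yes 2^≤n = ⊥-elim (<⇒≱ (n<1+n ⌊log₂ n ⌋)
                   (subst (_≤ ⌊log₂ n ⌋) (⌊log₂[2^n]⌋≡n (suc ⌊log₂ n ⌋)) (⌊log₂⌋-mono-≤ 2^≤n)))

geometric : ℕ → ℕ → ℕ → List ℕ
geometric T zero    c = [ c ]
geometric T (suc k) c = T ∷ geometric (2 * T) k c

applyUpTo-geometric : ∀ {f T} k c → (∀ i → f i ≡ T * 2 ^ i) → applyUpTo f k ++ [ c ] ≡ geometric T k c
applyUpTo-geometric         zero    c _  = refl
applyUpTo-geometric {f} {T} (suc k) c f≡ =
  cong₂ _∷_ (trans (f≡ 0) (*-identityʳ T)) (applyUpTo-geometric k c f∘suc≡)
  where
  f∘suc≡ : ∀ i → f (suc i) ≡ 2 * T * 2 ^ i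
  f∘suc≡ i = trans (f≡ (suc i)) (trans (sym (*-assoc T 2 (2 ^ i))) (cong (_* 2 ^ i) (*-comm T 2)))

LmAux-geometric : ∀ q k → LmAux q (suc (suc k)) ≡ geometric 4 k (2 * q + 4 ∸ 2 ^ suc (suc k))
LmAux-geometric q k =
  trans (cong (_++ [ c ]) (map-upTo (λ i → 2 ^ (i + 2)) k))
        (applyUpTo-geometric k c (λ i → trans (^-distribˡ-+-* 2 i 2) (*-comm (2 ^ i) 4)))
  where
  c = 2 * q + 4 ∸ 2 ^ suc (suc k)

2≤2^[n+2] : ∀ n → 2 ≤ 2 ^ (n + 2)
2≤2^[n+2] n = ≤-trans (s≤s (s≤s z≤n)) (^-monoʳ-≤ 2 (m≤n+m 2 n))

geometric-GoodFrom : ∀ {p c} k → 1 ≤ c → c ≤ 2 ^ (k + p + 2) → GoodFrom p (geometric (2 ^ (p + 2)) k c)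
geometric-GoodFrom         zero          1≤c c≤ = 1≤c , c≤ , z≤n , tt
geometric-GoodFrom {p}     (suc zero)    1≤c c≤ =
  2≤2^[n+2] p , ≤-refl , c≤ , geometric-GoodFrom {suc p} zero 1≤c c≤
geometric-GoodFrom {p} {c} (suc (suc k)) 1≤c c≤ =
  2≤2^[n+2] p , ≤-refl , ≤-refl ,
  geometric-GoodFrom {suc p} (suc k) 1≤c (subst (λ e → c ≤ 2 ^ (e + 2)) (sym (+-suc (suc k) p)) c≤)

geometric-sum : ∀ T k c → sum (geometric T k c) + T ≡ T * 2 ^ k + c
geometric-sum T zero    c = base T c
  where
  base : ∀ T c → c + 0 + T ≡ T * 1 + c
  base = solve-∀
geometric-sum T (suc k) c = begin
  T + S + T               ≡⟨ regroup T S ⟩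
  S + 2 * T               ≡⟨ geometric-sum (2 * T) k c ⟩
  2 * T * 2 ^ k + c       ≡⟨ cong (_+ c) (reassoc T (2 ^ k)) ⟩
  T * (2 * 2 ^ k) + c     ∎
  where
  open ≡-Reasoning
  S = sum (geometric (2 * T) k c)
  regroup : ∀ T S → T + S + T ≡ S + 2 * T
  regroup = solve-∀
  reassoc : ∀ T E → 2 * T * E ≡ T * (2 * E)
  reassoc = solve-∀

geometric-moment : ∀ T k c → moment (geometric T k c) + T * 2 ^ k ≡ T * k * 2 ^ k + T + suc k * c
geometric-moment T zero    c = base T c
  where
  base : ∀ T c → c + 0 + 0 + T * 1 ≡ T * 0 * 1 + T + (1 * c)
  base = solve-∀
geometric-moment T (suc k) c = +-cancelʳ-≡ (2 * T + 2 * T * E) _ _ (begin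
  T + S + Φ + T * (2 * E) + (2 * T + 2 * T * E)
    ≡⟨ regroup T S Φ E ⟩
  T + T * (2 * E) + (S + 2 * T) + (Φ + 2 * T * E)
    ≡⟨ cong₂ (λ s φ → T + T * (2 * E) + s + φ) (geometric-sum (2 * T) k c) (geometric-moment (2 * T) k c) ⟩
  T + T * (2 * E) + (2 * T * E + c) + (2 * T * k * E + 2 * T + (1 + k) * c)
    ≡⟨ collect T E k c ⟩
  T * (1 + k) * (2 * E) + T + (2 + k) * c + (2 * T + 2 * T * E) ∎)
  where
  open ≡-Reasoning
  E = 2 ^ k
  S = sum (geometric (2 * T) k c)
  Φ = moment (geometric (2 * T) k c)
  regroup : ∀ T S Φ E → T + S + Φ + T * (2 * E) + (2 * T + 2 * T * E)
                        ≡ T + T * (2 * E) + (S + 2 * T) + (Φ + 2 * T * E)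
  regroup = solve-∀
  collect : ∀ T E k c → T + T * (2 * E) + (2 * T * E + c) + (2 * T * k * E + 2 * T + (1 + k) * c)
                        ≡ T * (1 + k) * (2 * E) + T + (2 + k) * c + (2 * T + 2 * T * E)
  collect = solve-∀

geometric-sum-Lm : ∀ q k c → c + 2 ^ (2 + k) ≡ 2 * q + 4 → sum (geometric 4 k c) ≡ 2 * q
geometric-sum-Lm q k c c+2^≡ = +-cancelʳ-≡ 4 _ _ (begin
  sum (geometric 4 k c) + 4  ≡⟨ geometric-sum 4 k c ⟩
  4 * 2 ^ k + c              ≡⟨ swap (2 ^ k) c ⟩
  c + 2 ^ (2 + k)            ≡⟨ c+2^≡ ⟩
  2 * q + 4                  ∎)
  where
  open ≡-Reasoning
  swap : ∀ E c → 4 * E + c ≡ c + 2 * (2 * E)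
  swap = solve-∀

geometric-moment-Lm : ∀ q k c → c + 2 ^ (2 + k) ≡ 2 * q + 4 →
  moment (geometric 4 k c) + 2 * 2 ^ (2 + k) + 4 * q ≡ (2 + k + 1) * (2 * q) + 4 * (2 + k)
geometric-moment-Lm q k c c+2^≡ = +-cancelʳ-≡ ((1 + k) * (2 * q + 4)) _ _ (begin
  Φ + 2 * 2 ^ (2 + k) + 4 * q + (1 + k) * (2 * q + 4)
    ≡⟨ regroup Φ E q k ⟩
  (Φ + 4 * E) + 4 * E + 4 * q + (1 + k) * (2 * q + 4)
    ≡⟨ cong (λ x → x + 4 * E + 4 * q + (1 + k) * (2 * q + 4)) (geometric-moment 4 k c) ⟩
  (4 * k * E + 4 + (1 + k) * c) + 4 * E + 4 * q + (1 + k) * (2 * q + 4)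
    ≡⟨ collect E q k c ⟩
  (2 + k + 1) * (2 * q) + 4 * (2 + k) + (1 + k) * (c + 2 ^ (2 + k))
    ≡⟨ cong (λ x → (2 + k + 1) * (2 * q) + 4 * (2 + k) + (1 + k) * x) c+2^≡ ⟩
  (2 + k + 1) * (2 * q) + 4 * (2 + k) + (1 + k) * (2 * q + 4) ∎)
  where
  open ≡-Reasoning
  E = 2 ^ k
  Φ = moment (geometric 4 k c)
  regroup : ∀ Φ E q k → Φ + 2 * (2 * (2 * E)) + 4 * q + (1 + k) * (2 * q + 4)
                        ≡ (Φ + 4 * E) + 4 * E + 4 * q + (1 + k) * (2 * q + 4)
  regroup = solve-∀
  collect : ∀ E q k c → (4 * k * E + 4 + (1 + k) * c) + 4 * E + 4 * q + (1 + k) * (2 * q + 4)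
                        ≡ (2 + k + 1) * (2 * q) + 4 * (2 + k) + (1 + k) * (c + 2 * (2 * E))
  collect = solve-∀

LmAux-properties : ∀ q a → 2 ^ a ≤ 2 * q + 3 → 2 * q + 3 < 2 * 2 ^ a →
  GoodFrom 0 (LmAux q a) × sum (LmAux q a) ≡ 2 * q ×
  moment (LmAux q a) + 2 * 2 ^ a + 4 * q ≡ (a + 1) * (2 * q) + 4 * a
LmAux-properties q       zero          _ 2q+3<2 =
  ⊥-elim (<⇒≱ 2q+3<2 (≤-trans (s≤s (s≤s z≤n)) (m≤n+m 3 (2 * q))))
LmAux-properties zero    (suc zero)    _ _      = tt , refl , refl
LmAux-properties (suc q) (suc zero)    _ 2q+3<4 = ⊥-elim (<⇒≱ 2q+3<4 (+-monoˡ-≤ 3 (s≤s z≤n)))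
LmAux-properties q       (suc (suc k)) 2^a≤ <2*2^a rewrite LmAux-geometric q k =
  geometric-GoodFrom k 1≤c (subst (λ e → c ≤ 2 ^ e) (sym k+0+2≡) c≤2^a) ,
  geometric-sum-Lm q k c c+2^a≡ ,
  geometric-moment-Lm q k c c+2^a≡
  where
  open ≤-Reasoning
  c = 2 * q + 4 ∸ 2 ^ (2 + k)
  2q+3<2q+4 : 2 * q + 3 < 2 * q + 4
  2q+3<2q+4 = ≤-reflexive (sym (+-suc (2 * q) 3))
  2^a<2q+4 : 2 ^ (2 + k) < 2 * q + 4
  2^a<2q+4 = ≤-<-trans 2^a≤ 2q+3<2q+4
  c+2^a≡ : c + 2 ^ (2 + k) ≡ 2 * q + 4
  c+2^a≡ = m∸n+n≡m (<⇒≤ 2^a<2q+4)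
  1≤c : 1 ≤ c
  1≤c = m<n⇒0<n∸m 2^a<2q+4
  c≤2^a : c ≤ 2 ^ (2 + k)
  c≤2^a = +-cancelʳ-≤ (2 ^ (2 + k)) c _ (begin
    c + 2 ^ (2 + k)           ≡⟨ c+2^a≡ ⟩
    2 * q + 4                 ≡⟨ +-suc (2 * q) 3 ⟩
    suc (2 * q + 3)           ≤⟨ <2*2^a ⟩
    2 * 2 ^ (2 + k)           ≡⟨ cong (2 ^ (2 + k) +_) (+-identityʳ _) ⟩
    2 ^ (2 + k) + 2 ^ (2 + k) ∎)
  k+0+2≡ : k + 0 + 2 ≡ 2 + k
  k+0+2≡ = trans (cong (_+ 2) (+-identityʳ k)) (+-comm k 2)

Lm-properties : ∀ q → GoodFrom 0 (Lm q) × sum (Lm q) ≡ 2 * q ×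
  moment (Lm q) + 2 * 2 ^ aOf q + 4 * q ≡ (aOf q + 1) * (2 * q) + 4 * aOf q
Lm-properties q =
  LmAux-properties q (aOf q) (2^⌊log₂n⌋≤n (2 * q + 3) 1≤2q+3) (n<2*2^⌊log₂n⌋ (2 * q + 3))
  where
  1≤2q+3 : 1 ≤ 2 * q + 3
  1≤2q+3 = ≤-trans (s≤s z≤n) (m≤n+m 3 (2 * q))

Dmin≡ : ∀ t q → Dmin t q ≡ ℤ.+ ((3 * t + 1) * (2 * q) + 4 * q + moment (Lm q))
Dmin≡ t q = begin
  ℤ.+ X ℤ.- ℤ.+ B ℤ.+ ℤ.+ Y ℤ.+ ℤ.+ Z   ≡⟨ ℤ.+-assoc (ℤ.+ X ℤ.- ℤ.+ B) (ℤ.+ Y) (ℤ.+ Z) ⟩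
  ℤ.+ X ℤ.- ℤ.+ B ℤ.+ ℤ.+ (Y + Z)       ≡⟨ cong (λ n → ℤ.+ X ℤ.- ℤ.+ B ℤ.+ ℤ.+ n) (sym B+R≡Y+Z) ⟩
  ℤ.+ X ℤ.- ℤ.+ B ℤ.+ ℤ.+ (B + R)       ≡⟨ cancel (ℤ.+ X) (ℤ.+ B) (ℤ.+ R) ⟩
  ℤ.+ (X + R)                           ≡⟨ cong ℤ.+_ (sym (+-assoc X (4 * q) Φ)) ⟩
  ℤ.+ (X + 4 * q + Φ)                   ∎
  where
  open ≡-Reasoning
  a = aOf q
  X = (3 * t + 1) * (2 * q)
  B = 2 ^ (a + 1)
  Y = (a + 1) * (2 * q)
  Z = 4 * a
  Φ = moment (Lm q)
  R = 4 * q + Φ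
  rearrange : ∀ P Φ q → P + (4 * q + Φ) ≡ Φ + P + 4 * q
  rearrange = solve-∀
  B+R≡Y+Z : B + R ≡ Y + Z
  B+R≡Y+Z = begin
    2 ^ (a + 1) + R       ≡⟨ cong (λ e → 2 ^ e + R) (+-comm a 1) ⟩
    2 * 2 ^ a + R         ≡⟨ rearrange (2 * 2 ^ a) Φ q ⟩
    Φ + 2 * 2 ^ a + 4 * q ≡⟨ proj₂ (proj₂ (Lm-properties q)) ⟩
    Y + Z                 ∎
  cancel : ∀ x b r → x ℤ.- b ℤ.+ (b ℤ.+ r) ≡ x ℤ.+ r
  cancel = ℤ.solve-∀

Dmax≡ : ∀ t q → Dmax t q ≡ ℤ.+ ((3 * t + 1) * (2 * q) + 4 * q + (q * q + q))
Dmax≡ t q = cong ℤ.+_ (regroup ((3 * t + 1) * (2 * q)) q)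
  where
  regroup : ∀ X q → X + q * q + 5 * q ≡ X + 4 * q + (q * q + q)
  regroup = solve-∀

m+∣D-[b+m]∣≤n : ∀ {b m n} {D : ℤ} → ℤ.+ (b + m) ℤ.≤ D → D ℤ.≤ ℤ.+ (b + n) →
  m + ℤ.∣ D ℤ.- ℤ.+ (b + m) ∣ ≤ n
m+∣D-[b+m]∣≤n {b} {m} {n} (ℤ.+≤+ {n = d} b+m≤d) (ℤ.+≤+ d≤b+n) = begin
  m + ℤ.∣ ℤ.+ d ℤ.- ℤ.+ (b + m) ∣ ≡⟨ cong (λ z → m + ℤ.∣ z ∣) (trans (ℤ.m-n≡m⊖n d (b + m)) (ℤ.⊖-≥ b+m≤d)) ⟩
  m + (d ∸ (b + m))               ≤⟨ +-monoʳ-≤ m (∸-monoˡ-≤ (b + m) d≤b+n) ⟩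
  m + ((b + n) ∸ (b + m))         ≡⟨ cong (m +_) ([m+n]∸[m+o]≡n∸o b n m) ⟩
  m + (n ∸ m)                     ≡⟨ m+[n∸m]≡n (+-cancelˡ-≤ b m n (≤-trans b+m≤d d≤b+n)) ⟩
  n                               ∎
  where open ≤-Reasoning

Miter-steps-bound : ∀ t q {D} → Dmin t q ℤ.≤ D → D ℤ.≤ Dmax t q →
  moment (Lm q) + ℤ.∣ D ℤ.- Dmin t q ∣ ≤ q * q + q
Miter-steps-bound t q Dmin≤D D≤Dmax rewrite Dmin≡ t q | Dmax≡ t q = m+∣D-[b+m]∣≤n Dmin≤D D≤Dmax

lemma2p4 : (t q : ℕ) → 1 ≤ t → (D : ℤ) → Dmin t q ℤ.≤ D → D ℤ.≤ Dmax t q →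
    Σ (List ℕ) λ L → (Miter (ℤ.∣ D ℤ.- Dmin t q ∣) (Lm q) ≡ just L) × GoodSeq q L
lemma2p4 t q _ D Dmin≤D D≤Dmax =
  let good₀ , sum₀ , _ = Lm-properties q
      L , Miter≡ , good , sum≡ = Miter-GoodFrom q _ (Lm q) good₀ sum₀ (Miter-steps-bound t q Dmin≤D D≤Dmax)
  in L , Miter≡ , GoodFrom⇒GoodSeq q L good sum≡
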